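{- Let $n\ge 4$ be a composite integer and let $d\ge 2$ be a proper divisor of $n$. Then $S_{n-1}\equiv (-1)^{n+d}S_{d-1}\pmod d$.
   Context: The derangement numbers are $S_k=k!\sum_{i=0}^{k}\frac{(-1)^i}{i!}$ for $k=0,1,2,\ldots$. -}

module Defs where

open import Data.Nat using (ℕ; zero; suc; _!; _/_)
open import Data.Nat.Properties using (_!≢0)
open import Data.Integer using (ℤ; +_; -_; _+_; _*_)


sign : ℕ → ℤ
sign zero    = + 1
sign (suc i) = - sign i

sumTo : ℕ → (ℕ → ℤ) → ℤ
sumTo zero    f = f 0
sumTo (suc m) f = sumTo m f + f (suc m)

-- Derangement number S_k = k! Σ_{i=0}^{k} (-1)^i / i!  =  Σ_{i=0}^{k} (-1)^i (k!/i!)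
-- (k!/i! is an exact natural-number quotient for i ≤ k).
S : ℕ → ℤ
S k = sumTo k (λ i → sign i * + ((k !) / (i !)) {{i !≢0}})

module Submission where

-- Splitting off the last
-- term gives the classical recurrence  S_{k+1} = (k+1) S_k + (-1)^{k+1}.
-- From it we get a periodicity law: whenever d ∣ m,
--     S_{m+r} ≡ (-1)^m S_r   (mod d)    for every r,
-- by induction on r.  For r = 0 the recurrence gives S_m - (-1)^m = m S_{m-1}
-- (or 0 when m = 0), a multiple of d; for the step,
--     S_{m+r+1} - (-1)^m S_{r+1} = m S_{m+r} + (r+1)(S_{m+r} - (-1)^m S_r).
-- For a divisor d of n with 1 ≤ d ≤ n take m = n - d and r = d - 1: then
-- m + r = n - 1 and (-1)^{n+d} = (-1)^{m+2d} = (-1)^m, which is the claim.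

open import Defs
open import Data.Nat using (ℕ; _≤_; _<_; _∸_) renaming (_+_ to _+ℕ_)
open import Data.Nat.Divisibility using (_∣_)
open import Data.Nat.Primality using (Composite)
open import Data.Integer using (+_; _-_; _*_)
open import Data.Integer.Divisibility using () renaming (_∣_ to _∣ℤ_)

open import Data.Nat using (NonZero; zero; suc; z≤n; _!; _/_) renaming (_*_ to _*ℕ_)
open import Data.Nat.Properties using (_!≢0)
import Data.Nat.Properties as ℕ
import Data.Nat.DivMod as ℕ
import Data.Nat.Divisibility as ℕ
open import Data.Integer using (ℤ; _+_; -_; 1ℤ)
import Data.Integer.Properties as ℤ
open import Data.Integer.Divisibility.Signed using (∣ᵤ⇒∣; ∣⇒∣ᵤ; ∣m⇒∣m*n; ∣m∣n⇒∣m+n; ∣n⇒∣m*n)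
  renaming (_∣_ to _∣ˢ_)
open import Data.Integer.Tactic.RingSolver using (solve-∀)
open import Relation.Binary.PropositionalEquality
open ≡-Reasoning

sumTo-cong : ∀ k (f g : ℕ → ℤ) → (∀ i → i ≤ k → f i ≡ g i) → sumTo k f ≡ sumTo k g
sumTo-cong zero    f g f≗g = f≗g 0 z≤n
sumTo-cong (suc k) f g f≗g =
  cong₂ _+_ (sumTo-cong k f g (λ i i≤k → f≗g i (ℕ.m≤n⇒m≤1+n i≤k)))
            (f≗g (suc k) ℕ.≤-refl)

sumTo-scale : ∀ k c (f : ℕ → ℤ) → sumTo k (λ i → c * f i) ≡ c * sumTo k f
sumTo-scale zero    c f = refl
sumTo-scale (suc k) c f = begin
  sumTo k (λ i → c * f i) + c * f (suc k) ≡⟨ cong (_+ c * f (suc k)) (sumTo-scale k c f) ⟩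
  c * sumTo k f + c * f (suc k)           ≡⟨ ℤ.*-distribˡ-+ c (sumTo k f) (f (suc k)) ⟨
  c * sumTo (suc k) f                     ∎

term : ℕ → ℕ → ℤ
term k i = sign i * + ((k !) / (i !)) {{i !≢0}}

-- For i ≤ k the summands of S_{k+1} are (k+1) times those of S_k,
-- because (k+1)!/i! = (k+1)·(k!/i!) when i! ∣ k!.
term-suc : ∀ k i → i ≤ k → term (suc k) i ≡ + suc k * term k i
term-suc k i i≤k = begin
  sign i * + ((suc k *ℕ k !) / i !)       ≡⟨ cong (λ x → sign i * + x)
                                              (ℕ.*-/-assoc (suc k) (ℕ.m≤n⇒m!∣n! i≤k)) ⟩
  sign i * + (suc k *ℕ (k ! / i !))     ≡⟨ cong (sign i *_) (ℤ.pos-* (suc k) _) ⟩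
  sign i * (+ suc k * + (k ! / i !))     ≡⟨ swap (sign i) (+ suc k) (+ (k ! / i !)) ⟩
  + suc k * (sign i * + (k ! / i !))     ∎
  where
  instance
    i!≢0 : NonZero (i !)
    i!≢0 = i !≢0
  swap : ∀ a b c → a * (b * c) ≡ b * (a * c)
  swap = solve-∀

term-last : ∀ k → term k k ≡ sign k
term-last k = begin
  sign k * + (k ! / k !) ≡⟨ cong (λ x → sign k * + x) (ℕ.n/n≡1 (k !)) ⟩
  sign k * 1ℤ            ≡⟨ ℤ.*-identityʳ (sign k) ⟩
  sign k                 ∎
  where
  instance
    k!≢0 : NonZero (k !)
    k!≢0 = k !≢0

S-suc : ∀ k → S (suc k) ≡ + suc k * S k + sign (suc k)
S-suc k = cong₂ _+_ scaled (term-last (suc k))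
  where
  scaled : sumTo k (term (suc k)) ≡ + suc k * S k
  scaled = trans (sumTo-cong k _ _ (term-suc k)) (sumTo-scale k (+ suc k) (term k))

sign-+ : ∀ a b → sign (a +ℕ b) ≡ sign a * sign b
sign-+ zero    b = sym (ℤ.*-identityˡ (sign b))
sign-+ (suc a) b = trans (cong -_ (sign-+ a b)) (ℤ.neg-distribˡ-* (sign a) (sign b))

sign-double : ∀ a → sign (a +ℕ a) ≡ 1ℤ
sign-double zero    = refl
sign-double (suc a) = begin
  - sign (a +ℕ suc a)     ≡⟨ cong (λ x → - sign x) (ℕ.+-suc a a) ⟩
  - - sign (a +ℕ a)       ≡⟨ ℤ.neg-involutive (sign (a +ℕ a)) ⟩
  sign (a +ℕ a)           ≡⟨ sign-double a ⟩
  1ℤ                      ∎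

ℕ∣⇒ℤ∣ : ∀ {d m} → d ∣ m → + d ∣ˢ + m
ℕ∣⇒ℤ∣ = ∣ᵤ⇒∣

-- Base case of periodicity: S_m ≡ (-1)^m (mod d) when d ∣ m,
-- since S_m - (-1)^m = m S_{m-1} for m ≥ 1.
S-multiple : ∀ {d} m → d ∣ m → + d ∣ˢ (S m - sign m)
S-multiple zero    _   = ℕ∣⇒ℤ∣ (_ ℕ.∣0)
S-multiple (suc k) d∣m = subst (+ _ ∣ˢ_) (sym split) (∣m⇒∣m*n (S k) (ℕ∣⇒ℤ∣ d∣m))
  where
  split : S (suc k) - sign (suc k) ≡ + suc k * S k
  split = begin
    S (suc k) - sign (suc k)                        ≡⟨ cong (_- sign (suc k)) (S-suc k) ⟩
    + suc k * S k + sign (suc k) - sign (suc k)     ≡⟨ cancel (+ suc k * S k) (sign (suc k)) ⟩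
    + suc k * S k                                   ∎
    where
    cancel : ∀ x s → x + s - s ≡ x
    cancel = solve-∀

S-periodic : ∀ {d m} → d ∣ m → ∀ r → + d ∣ˢ (S (m +ℕ r) - sign m * S r)
S-periodic {d} {m} d∣m zero =
  subst (λ x → + d ∣ˢ (S x - sign m * S 0)) (sym (ℕ.+-identityʳ m))
    (subst (λ y → + d ∣ˢ (S m - y)) (sym (ℤ.*-identityʳ (sign m))) (S-multiple m d∣m))
S-periodic {d} {m} d∣m (suc r) = subst (+ d ∣ˢ_) (sym step)
  (∣m∣n⇒∣m+n (∣m⇒∣m*n (S (m +ℕ r)) (ℕ∣⇒ℤ∣ d∣m)) (∣n⇒∣m*n (+ suc r) (S-periodic d∣m r)))
  where
  size : + suc (m +ℕ r) ≡ + m + + suc r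
  size = trans (cong +_ (sym (ℕ.+-suc m r))) (ℤ.pos-+ m (suc r))
  sgn : sign (suc (m +ℕ r)) ≡ sign m * sign (suc r)
  sgn = trans (cong sign (sym (ℕ.+-suc m r))) (sign-+ m (suc r))
  regroup : ∀ a b x g y s → (a + b) * x + g * s - g * (b * y + s) ≡ a * x + b * (x - g * y)
  regroup = solve-∀
  step : S (m +ℕ suc r) - sign m * S (suc r)
       ≡ + m * S (m +ℕ r) + + suc r * (S (m +ℕ r) - sign m * S r)
  step = begin
    S (m +ℕ suc r) - sign m * S (suc r)
      ≡⟨ cong₂ (λ x y → S x - sign m * y) (ℕ.+-suc m r) (S-suc r) ⟩
    S (suc (m +ℕ r)) - sign m * (+ suc r * S r + sign (suc r))
      ≡⟨ cong (_- sign m * (+ suc r * S r + sign (suc r))) (S-suc (m +ℕ r)) ⟩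
    + suc (m +ℕ r) * S (m +ℕ r) + sign (suc (m +ℕ r)) - sign m * (+ suc r * S r + sign (suc r))
      ≡⟨ cong₂ (λ x y → x * S (m +ℕ r) + y - sign m * (+ suc r * S r + sign (suc r))) size sgn ⟩
    (+ m + + suc r) * S (m +ℕ r) + sign m * sign (suc r) - sign m * (+ suc r * S r + sign (suc r))
      ≡⟨ regroup (+ m) (+ suc r) (S (m +ℕ r)) (sign m) (S r) (sign (suc r)) ⟩
    + m * S (m +ℕ r) + + suc r * (S (m +ℕ r) - sign m * S r)
      ∎

-- The general congruence: for every divisor d of n with 1 ≤ d ≤ n,
-- S_{n-1} ≡ (-1)^{n+d} S_{d-1} (mod d).  Apply periodicity with m = n - d.
S-divisor-congruence : ∀ n d → 1 ≤ d → d ≤ n → d ∣ n →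
  + d ∣ˢ (S (n ∸ 1) - sign (n +ℕ d) * S (d ∸ 1))
S-divisor-congruence n d 1≤d d≤n d∣n =
  subst₂ (λ k s → + d ∣ˢ (S k - s * S (d ∸ 1))) index sgn
    (S-periodic d∣m (d ∸ 1))
  where
  m = n ∸ d
  d∣m : d ∣ m
  d∣m = ℕ.∣m+n∣m⇒∣n (subst (d ∣_) (sym (ℕ.m+[n∸m]≡n d≤n)) d∣n) ℕ.∣-refl
  index : m +ℕ (d ∸ 1) ≡ n ∸ 1
  index = begin
    m +ℕ (d ∸ 1)   ≡⟨ ℕ.+-∸-assoc m 1≤d ⟨
    m +ℕ d ∸ 1     ≡⟨ cong (_∸ 1) (ℕ.m∸n+n≡m d≤n) ⟩
    n ∸ 1          ∎
  sgn : sign m ≡ sign (n +ℕ d)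
  sgn = begin
    sign m                    ≡⟨ ℤ.*-identityʳ (sign m) ⟨
    sign m * 1ℤ               ≡⟨ cong (sign m *_) (sign-double d) ⟨
    sign m * sign (d +ℕ d)    ≡⟨ sign-+ m (d +ℕ d) ⟨
    sign (m +ℕ (d +ℕ d))      ≡⟨ cong sign (ℕ.+-assoc m d d) ⟨
    sign (m +ℕ d +ℕ d)        ≡⟨ cong (λ x → sign (x +ℕ d)) (ℕ.m∸n+n≡m d≤n) ⟩
    sign (n +ℕ d)             ∎

proposition3 : (n d : ℕ) → 4 ≤ n → Composite n → 2 ≤ d → d ∣ n → d < n →
    (+ d) ∣ℤ (S (n ∸ 1) - sign (n +ℕ d) * S (d ∸ 1))
proposition3 n d _ _ 2≤d d∣n d<n =
  ∣⇒∣ᵤ (S-divisor-congruence n d (ℕ.<⇒≤ 2≤d) (ℕ.<⇒≤ d<n) d∣n)
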